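{- For every nonnegative integer $n$, the Tribonacci successor satisfies \[\alpha n-0.85<\operatorname{out}(n)<\alpha n+0.85,\] where $\alpha$ is the real root of $x^3-x^2-x-1=0$.
   Context: Tribonacci numbers: $T_0=0$, $T_1=0$, $T_2=1$, and $T_n=T_{n-1}+T_{n-2}+T_{n-3}$ for $n\ge 3$ (so $T_3=1,T_4=2,T_5=4,T_6=7,T_7=13,\dots$). Every nonnegative integer $N$ has a unique (canonical) Tribonacci representation as a sum of distinct Tribonacci numbers $T_i$ with indices $i\ge 3$, no three of the indices being consecutive. If $N=T_{i_1}+\cdots+T_{i_k}$ is this representation, the Tribonacci successor is $\operatorname{out}(N)=T_{i_1+1}+\cdots+T_{i_k+1}$ (and $\operatorname{out}(0)=0$). The constant $\alpha\approx 1.839$ is the Tribonacci constant, the real root of $x^3-x^2-x-1$. -}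

module Defs where

open import Data.Nat using (ℕ; zero; suc; _+_)
open import Data.List using (List; []; _∷_; map)
open import Data.Nat.ListAction using (sum)
open import Data.List.Membership.Propositional using (_∈_; _∉_)
open import Data.List.Relation.Unary.Unique.Propositional using (Unique)
open import Data.List.Relation.Unary.All using (All)
open import Data.Integer using (+_)
open import Data.Rational using (ℚ; _/_; _*_; _-_; _<_; 0ℚ)
open import Data.Product using (_×_)
import Data.Nat as ℕ

T : ℕ → ℕ
T 0 = 0
T 1 = 0
T 2 = 1
T (suc (suc (suc n))) = T (suc (suc n)) + T (suc n) + T n

IsCanonicalRep : List ℕ → ℕ → Set
IsCanonicalRep is N =
  Unique is
  × All (λ i → 3 ℕ.≤ i) is
  × (∀ i → i ∈ is → suc i ∈ is → suc (suc i) ∉ is)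
  × sum (map T is) ≡ℕ N
  where
  open import Relation.Binary.PropositionalEquality using () renaming (_≡_ to _≡ℕ_)

outOf : List ℕ → ℕ
outOf is = sum (map (λ i → T (suc i)) is)

toℚ : ℕ → ℚ
toℚ n = (+ n) / 1

-- Homogenised Tribonacci cubic:  cubicH y x = y³ - y²x - yx² - x³ = x³ p(y/x)
-- with p(t) = t³ - t² - t - 1.  Since p(t) < 0 ⇔ t < α and p(t) > 0 ⇔ t > α for
-- every real t (α is the unique real root, p has a sign change only there),
-- for x ≥ 0 we get  y < α·x ⇔ cubicH y x < 0  and  α·x < y ⇔ cubicH y x > 0
-- (also for x = 0, where the conditions read y < 0, resp. y > 0).
cubicH : ℚ → ℚ → ℚ
cubicH y x = y * y * y - y * y * x - y * x * x - x * x * x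

_<α·_ : ℚ → ℕ → Set
y <α· n = cubicH y (toℚ n) < 0ℚ

α·_<_ : ℕ → ℚ → Set
α· n < y = 0ℚ < cubicH y (toℚ n)

c085 : ℚ
c085 = (+ 17) / 20

{-# OPTIONS --safe #-}

-- If n = T i₁ + ⋯ + T iₖ canonically, then out(n) − t n = ε i₁ t + ⋯ + ε iₖ t with
-- ε i t = T (i + 1) − t T i.  At t = α the positive ε i α with i ≥ 3 add up to about 0.8483 and the
-- negative ones to about −0.590, so the estimate holds for every sum of distinct T i with i ≥ 3.
-- Since α enters only through the sign of the cubic, each claim about α is proved for all t in some
-- bisection bracket around α.  For i < 34, ε i is decreasing in t and is evaluated exactly at the
-- ends of the first bracket.  For larger i, the quadratic form Q i in (ε i, ε (i + 1)) is multiplied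
-- by κ t = t² − t − 1, which is 1/α < 9/16 at α, up to a multiple of p t = t³ − t² − t − 1 that
-- vanishes at α; this gives ∣ε i∣ ≤ 1.82 (3/4)ⁱ near α, which sums to less than 10⁻³ over i ≥ 34.
-- Finally, y < l x with p l ≤ 0 makes the cubic negative, as
-- cubicH y x = x³ p l + (y − l x) G l y x with G l positive definite; symmetrically at the upper end.

module Submission where

open import Defs
open import Data.Nat using (ℕ)
open import Data.List using (List)
open import Data.Product using (_×_; ∃)

-- Existence of canonical representations

module _ where
  open import Data.Nat using (zero; suc; _+_; _∸_; _≤_; _<_; _<?_; z≤n; s≤s)
  open import Data.Nat.Properties
  open import Data.List using ([]; _∷_)
  open import Data.List.Membership.Propositional using (_∈_)
  open import Data.List.Relation.Unary.Any using (here; there)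
  open import Data.List.Relation.Unary.All as All using (All; []; _∷_)
  open import Data.List.Relation.Unary.AllPairs using ([]; _∷_)
  open import Data.Product using (_,_; proj₁)
  open import Data.Empty using (⊥; ⊥-elim)
  open import Function using (_∘_)
  open import Relation.Nullary using (yes; no; ¬_)
  open import Relation.Binary.PropositionalEquality

  ∈-tail : ∀ {a i : ℕ} {is} → i ∈ a ∷ is → i ≢ a → i ∈ is
  ∈-tail (here i≡a) i≢a = ⊥-elim (i≢a i≡a)
  ∈-tail (there i∈is) _ = i∈is

  empty-rep : IsCanonicalRep [] 0
  empty-rep = [] , [] , (λ _ ()) , refl

  cons-rep : ∀ {a is m} → 3 ≤ a → All (_< a) is → (∀ {i} → suc (suc i) ≡ a → ¬ (i ∈ is × suc i ∈ is)) →
             IsCanonicalRep is m → IsCanonicalRep (a ∷ is) (T a + m)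
  cons-rep {a} {is} 3≤a is<a no-run (unique , 3≤is , no-three , sum≡m) =
      All.map (λ i<a a≡i → <-irrefl (sym a≡i) i<a) is<a ∷ unique
    , 3≤a ∷ 3≤is
    , no-three′
    , cong (T a +_) sum≡m
    where
    no-three′ : ∀ i → i ∈ a ∷ is → suc i ∈ a ∷ is → suc (suc i) ∈ a ∷ is → ⊥
    no-three′ i i∈ si∈ (here ssi≡a) =
      no-run ssi≡a ( ∈-tail i∈ (<⇒≢ (≤-<-trans (n≤1+n i) (≤-reflexive ssi≡a)))
                   , ∈-tail si∈ (<⇒≢ (≤-reflexive ssi≡a)))
    no-three′ i i∈ si∈ (there ssi∈is) = no-three i (∈-tail i∈ (<⇒≢ i<a)) (∈-tail si∈ (<⇒≢ si<a)) ssi∈is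
      where
      si<a : suc i < a
      si<a = <-trans (n<1+n (suc i)) (All.lookup is<a ssi∈is)
      i<a : i < a
      i<a = <-trans (n<1+n i) si<a

  no-run-below : ∀ {a is} → All (λ i → suc i < a) is → ∀ {i} → suc (suc i) ≡ a → ¬ (i ∈ is × suc i ∈ is)
  no-run-below is<a ssi≡a (_ , si∈is) = <-irrefl ssi≡a (All.lookup is<a si∈is)

  RepBelow : ℕ → ℕ → Set
  RepBelow k m = ∃ λ is → IsCanonicalRep is m × All (_< k) is

  RepsBelow : ℕ → Set
  RepsBelow k = ∀ {m} → m < T k → RepBelow k m

  2≤index : ∀ {k m} → m < T k → 2 ≤ k
  2≤index {suc (suc k)} _ = s≤s (s≤s z≤n)

  ∸-<-split : ∀ {m} x y → x ≤ m → m < x + y → m ∸ x < y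
  ∸-<-split x y x≤m m<x+y = subst (_ <_) (m+n∸m≡n x y) (∸-monoˡ-< m<x+y x≤m)

  -- Greedy: as T (k + 3) = T (k + 2) + T (k + 1) + T k, after taking T (k + 2) and, if still needed,
  -- T (k + 1), what is left lies below T (k + 1), resp. T k.
  reps-step : ∀ k → RepsBelow k → RepsBelow (suc k) → RepsBelow (suc (suc k)) → RepsBelow (suc (suc (suc k)))
  reps-step k below₀ below₁ below₂ {m} m<T with m <? T (suc (suc k))
  ... | yes m<T₂ = let is , rep , is<k = below₂ m<T₂ in is , rep , All.map m<n⇒m<1+n is<k
  ... | no m≮T₂ = subst (RepBelow _) (m+[n∸m]≡n T₂≤m)
      (with-T₂ (m ∸ T (suc (suc k))) (∸-<-split _ _ T₂≤m (subst (m <_) (+-assoc (T (suc (suc k))) (T (suc k)) (T k)) m<T)))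
    where
    T₂≤m = ≮⇒≥ m≮T₂
    no-run-at-top : ∀ {is} → All (_< k) is →
                    ∀ {i} → suc (suc i) ≡ suc (suc k) → ¬ (i ∈ suc k ∷ is × suc i ∈ suc k ∷ is)
    no-run-at-top is<k refl (here k≡1+k , _) = 1+n≢n (sym k≡1+k)
    no-run-at-top is<k refl (there k∈is , _) = <-irrefl refl (All.lookup is<k k∈is)
    with-T₁ : ∀ {r} → r < T k → RepBelow (suc (suc (suc k))) (T (suc (suc k)) + (T (suc k) + r))
    with-T₁ r<T₀ = let is , rep , is<k = below₀ r<T₀ in
        suc (suc k) ∷ suc k ∷ is
      , cons-rep (s≤s (m≤n⇒m≤1+n (2≤index r<T₀)))
          (n<1+n _ ∷ All.map (m<n⇒m<1+n ∘ m<n⇒m<1+n) is<k)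
          (no-run-at-top is<k)
          (cons-rep (s≤s (2≤index r<T₀)) (All.map m<n⇒m<1+n is<k) (no-run-below (All.map s≤s is<k)) rep)
      , n<1+n _ ∷ m<n⇒m<1+n (n<1+n _) ∷ All.map (m<n⇒m<1+n ∘ m<n⇒m<1+n ∘ m<n⇒m<1+n) is<k
    with-T₂ : ∀ r → r < T (suc k) + T k → RepBelow (suc (suc (suc k))) (T (suc (suc k)) + r)
    with-T₂ r r<T₁+T₀ with r <? T (suc k)
    ... | yes r<T₁ = let is , rep , is<k = below₁ r<T₁ in
          suc (suc k) ∷ is
        , cons-rep (s≤s (2≤index r<T₁)) (All.map m<n⇒m<1+n is<k) (no-run-below (All.map s≤s is<k)) rep
        , n<1+n _ ∷ All.map (m<n⇒m<1+n ∘ m<n⇒m<1+n) is<k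
    ... | no r≮T₁ = subst (λ r → RepBelow _ (T (suc (suc k)) + r)) (m+[n∸m]≡n T₁≤r)
          (with-T₁ (∸-<-split _ _ T₁≤r r<T₁+T₀))
      where T₁≤r = ≮⇒≥ r≮T₁

  reps : ∀ k → RepsBelow k × RepsBelow (suc k) × RepsBelow (suc (suc k))
  reps zero = (λ ()) , (λ ()) , λ { (s≤s z≤n) → [] , empty-rep , [] }
  reps (suc k) = let below₀ , below₁ , below₂ = reps k in below₁ , below₂ , reps-step k below₀ below₁ below₂

  1≤T[2+n] : ∀ n → 1 ≤ T (suc (suc n))
  1≤T[2+n] zero = s≤s z≤n
  1≤T[2+n] (suc n) = ≤-trans (1≤T[2+n] n) (≤-trans (m≤m+n _ _) (m≤m+n _ _))

  n<T[3+n] : ∀ n → n < T (suc (suc (suc n)))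
  n<T[3+n] zero = s≤s z≤n
  n<T[3+n] (suc n) = begin-strict
    suc n                                      <⟨ s≤s (n<T[3+n] n) ⟩
    suc T₃                                     ≡⟨ +-comm 1 T₃ ⟩
    T₃ + 1                                     ≤⟨ +-monoʳ-≤ T₃ (1≤T[2+n] n) ⟩
    T₃ + T (suc (suc n))                       ≤⟨ m≤m+n _ (T (suc n)) ⟩
    T₃ + T (suc (suc n)) + T (suc n)           ∎
    where
    open ≤-Reasoning
    T₃ = T (suc (suc (suc n)))

  canonicalRep-exists : ∀ n → ∃ λ is → IsCanonicalRep is n
  canonicalRep-exists n = let is , rep , _ = proj₁ (reps (suc (suc (suc n)))) (n<T[3+n] n) in is , rep

open import Data.Nat using (ℕ; zero; suc)
import Data.Nat as ℕ
import Data.Nat.Properties as ℕ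
import Data.Integer as ℤ
open import Data.Rational
open import Data.Rational.Properties
open import Data.List using (List; []; _∷_; map)
open import Data.Nat.ListAction using (sum)
open import Data.List.Relation.Unary.Unique.Propositional using (Unique)
open import Data.List.Relation.Unary.AllPairs using ([]; _∷_)
open import Data.List.Relation.Unary.All as All using (All; []; _∷_)
open import Data.Product using (_×_; _,_; proj₁; proj₂; ∃; ∃-syntax)
open import Data.Sum using (inj₁; inj₂)
open import Relation.Binary using (tri<; tri≈; tri>)
open import Relation.Binary.PropositionalEquality
open import Relation.Nullary using (contradiction)
open import Relation.Nullary.Decidable using (Dec; from-yes; yes; no)
import Data.Nat.Coprimality as Coprime
import Data.Integer.Properties as ℤ
open import Data.Rational.Solver using (module +-*-Solver)
open +-*-Solver using (solve; Polynomial; _:+_; _:*_; _:-_; :-_; con; _:=_)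
open import Algebra.Bundles using (CommutativeMonoid)
open import Algebra.Properties.CommutativeSemigroup (CommutativeMonoid.commutativeSemigroup *-1-commutativeMonoid) using (x∙yz≈y∙xz)

toℚ-suc : ∀ n → toℚ (suc n) ≡ 1ℚ + toℚ n
toℚ-suc n rewrite normalize-coprime (Coprime.sym (Coprime.1-coprimeTo n)) | ℕ.*-identityʳ n | ℤ.+◃n≡+n n = refl

toℚ-+ : ∀ m n → toℚ (m ℕ.+ n) ≡ toℚ m + toℚ n
toℚ-+ zero n = sym (+-identityˡ (toℚ n))
toℚ-+ (suc m) n = begin
  toℚ (suc (m ℕ.+ n))   ≡⟨ toℚ-suc (m ℕ.+ n) ⟩
  1ℚ + toℚ (m ℕ.+ n)    ≡⟨ cong (1ℚ +_) (toℚ-+ m n) ⟩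
  1ℚ + (toℚ m + toℚ n)  ≡⟨ +-assoc 1ℚ (toℚ m) (toℚ n) ⟨
  1ℚ + toℚ m + toℚ n    ≡⟨ cong (_+ toℚ n) (toℚ-suc m) ⟨
  toℚ (suc m) + toℚ n   ∎
  where open ≡-Reasoning

toℚ-* : ∀ m n → toℚ (m ℕ.* n) ≡ toℚ m * toℚ n
toℚ-* zero n = sym (*-zeroˡ (toℚ n))
toℚ-* (suc m) n = begin
  toℚ (n ℕ.+ m ℕ.* n)      ≡⟨ toℚ-+ n (m ℕ.* n) ⟩
  toℚ n + toℚ (m ℕ.* n)    ≡⟨ cong (toℚ n +_) (toℚ-* m n) ⟩
  toℚ n + toℚ m * toℚ n    ≡⟨ distrib (toℚ m) (toℚ n) ⟩
  (1ℚ + toℚ m) * toℚ n     ≡⟨ cong (_* toℚ n) (toℚ-suc m) ⟨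
  toℚ (suc m) * toℚ n      ∎
  where
  open ≡-Reasoning
  distrib : ∀ x y → y + x * y ≡ (1ℚ + x) * y
  distrib = solve 2 (λ x y → y :+ x :* y := (con 1ℚ :+ x) :* y) refl

toℚ-nonNeg : ∀ n → 0ℚ ≤ toℚ n
toℚ-nonNeg n = nonNegative⁻¹ (toℚ n) {{normalize-nonNeg n 1}}

∣toℚ∣ : ∀ n → ∣ toℚ n ∣ ≡ toℚ n
∣toℚ∣ n = 0≤p⇒∣p∣≡p (toℚ-nonNeg n)

p≤q⇒0≤q-p : ∀ {p q} → p ≤ q → 0ℚ ≤ q - p
p≤q⇒0≤q-p {p} {q} p≤q = begin
  0ℚ     ≡⟨ +-inverseʳ p ⟨
  p - p  ≤⟨ +-monoˡ-≤ (- p) p≤q ⟩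
  q - p  ∎
  where open ≤-Reasoning

p<q⇒0<q-p : ∀ {p q} → p < q → 0ℚ < q - p
p<q⇒0<q-p {p} {q} p<q = begin-strict
  0ℚ     ≡⟨ +-inverseʳ p ⟨
  p - p  <⟨ +-monoˡ-< (- p) p<q ⟩
  q - p  ∎
  where open ≤-Reasoning

p+[q-p]≡q : ∀ p q → p + (q - p) ≡ q
p+[q-p]≡q = solve 2 (λ p q → p :+ (q :- p) := q) refl

neg-involutive : ∀ p → - - p ≡ p
neg-involutive = solve 1 (λ p → :- :- p := p) refl

-q≤p⇒-p≤q : ∀ {p q} → - q ≤ p → - p ≤ q
-q≤p⇒-p≤q {p} {q} -q≤p = subst (- p ≤_) (neg-involutive q) (neg-antimono-≤ -q≤p)

-p<q⇒-q<p : ∀ {p q} → - p < q → - q < p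
-p<q⇒-q<p {p} {q} -p<q = subst (- q <_) (neg-involutive p) (neg-antimono-< -p<q)

≤-by-difference : ∀ {p q} d → q - p ≡ d → 0ℚ ≤ d → p ≤ q
≤-by-difference {p} {q} d q-p≡d 0≤d = begin
  p            ≡⟨ +-identityʳ p ⟨
  p + 0ℚ       ≤⟨ +-monoʳ-≤ p 0≤d ⟩
  p + d        ≡⟨ cong (p +_) q-p≡d ⟨
  p + (q - p)  ≡⟨ p+[q-p]≡q p q ⟩
  q            ∎
  where open ≤-Reasoning

<-by-difference : ∀ {p q} d → q - p ≡ d → 0ℚ < d → p < q
<-by-difference {p} {q} d q-p≡d 0<d = begin-strict
  p            ≡⟨ +-identityʳ p ⟨
  p + 0ℚ       <⟨ +-monoʳ-< p 0<d ⟩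
  p + d        ≡⟨ cong (p +_) q-p≡d ⟨
  p + (q - p)  ≡⟨ p+[q-p]≡q p q ⟩
  q            ∎
  where open ≤-Reasoning

sub-mono-≤ : ∀ {p p′ q q′} → p ≤ p′ → q′ ≤ q → p - q ≤ p′ - q′
sub-mono-≤ p≤p′ q′≤q = +-mono-≤ p≤p′ (neg-antimono-≤ q′≤q)

+-nonNeg : ∀ {p q} → 0ℚ ≤ p → 0ℚ ≤ q → 0ℚ ≤ p + q
+-nonNeg = +-mono-≤

*-nonNeg : ∀ {p q} → 0ℚ ≤ p → 0ℚ ≤ q → 0ℚ ≤ p * q
*-nonNeg {p} {q} 0≤p 0≤q =
  nonNegative⁻¹ (p * q) {{nonNeg*nonNeg⇒nonNeg p {{nonNegative 0≤p}} q {{nonNegative 0≤q}}}}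

*-pos : ∀ {p q} → 0ℚ < p → 0ℚ < q → 0ℚ < p * q
*-pos {p} {q} 0<p 0<q = positive⁻¹ (p * q) {{pos*pos⇒pos p {{positive 0<p}} q {{positive 0<q}}}}

*-mono-≤-nonNeg : ∀ {p p′ q q′} → 0ℚ ≤ p → p ≤ p′ → 0ℚ ≤ q → q ≤ q′ → p * q ≤ p′ * q′
*-mono-≤-nonNeg {p} {p′} {q} {q′} 0≤p p≤p′ 0≤q q≤q′ = begin
  p * q    ≤⟨ *-monoʳ-≤-nonNeg q {{nonNegative 0≤q}} p≤p′ ⟩
  p′ * q   ≤⟨ *-monoˡ-≤-nonNeg p′ {{nonNegative (≤-trans 0≤p p≤p′)}} q≤q′ ⟩
  p′ * q′  ∎
  where open ≤-Reasoning

p≤∣p∣ : ∀ p → p ≤ ∣ p ∣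
p≤∣p∣ p with ≤-total 0ℚ p
... | inj₁ 0≤p = ≤-reflexive (sym (0≤p⇒∣p∣≡p 0≤p))
... | inj₂ p≤0 = ≤-trans p≤0 (0≤∣p∣ p)

-∣p∣≤p : ∀ p → - ∣ p ∣ ≤ p
-∣p∣≤p p = begin
  - ∣ p ∣    ≡⟨ cong -_ (∣-p∣≡∣p∣ p) ⟨
  - ∣ - p ∣  ≤⟨ neg-antimono-≤ (p≤∣p∣ (- p)) ⟩
  - - p      ≡⟨ neg-involutive p ⟩
  p          ∎
  where open ≤-Reasoning

∣p∣≤q⇒p≤q : ∀ {p q} → ∣ p ∣ ≤ q → p ≤ q
∣p∣≤q⇒p≤q {p} = ≤-trans (p≤∣p∣ p)

∣p∣≤q⇒-q≤p : ∀ {p q} → ∣ p ∣ ≤ q → - q ≤ p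
∣p∣≤q⇒-q≤p {p} ∣p∣≤q = ≤-trans (neg-antimono-≤ ∣p∣≤q) (-∣p∣≤p p)

-q≤p≤q⇒∣p∣≤q : ∀ {p q} → - q ≤ p → p ≤ q → ∣ p ∣ ≤ q
-q≤p≤q⇒∣p∣≤q {p} {q} -q≤p p≤q with ∣p∣≡p∨∣p∣≡-p p
... | inj₁ ∣p∣≡p  = subst (_≤ q) (sym ∣p∣≡p) p≤q
... | inj₂ ∣p∣≡-p = subst₂ _≤_ (sym ∣p∣≡-p) (neg-involutive q) (neg-antimono-≤ -q≤p)

∣p*q∣≤r*s : ∀ {p q r s} → ∣ p ∣ ≤ r → ∣ q ∣ ≤ s → ∣ p * q ∣ ≤ r * s
∣p*q∣≤r*s {p} {q} ∣p∣≤r ∣q∣≤s = begin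
  ∣ p * q ∣        ≡⟨ ∣p*q∣≡∣p∣*∣q∣ p q ⟩
  ∣ p ∣ * ∣ q ∣    ≤⟨ *-mono-≤-nonNeg (0≤∣p∣ p) ∣p∣≤r (0≤∣p∣ q) ∣q∣≤s ⟩
  _                ∎
  where open ≤-Reasoning

∣p+q∣≤r+s : ∀ {p q r s} → ∣ p ∣ ≤ r → ∣ q ∣ ≤ s → ∣ p + q ∣ ≤ r + s
∣p+q∣≤r+s {p} {q} ∣p∣≤r ∣q∣≤s = ≤-trans (∣p+q∣≤∣p∣+∣q∣ p q) (+-mono-≤ ∣p∣≤r ∣q∣≤s)

∣p-q∣≤r+s : ∀ {p q r s} → ∣ p ∣ ≤ r → ∣ q ∣ ≤ s → ∣ p - q ∣ ≤ r + s
∣p-q∣≤r+s {p} {q} ∣p∣≤r ∣q∣≤s = ≤-trans (∣p-q∣≤∣p∣+∣q∣ p q) (+-mono-≤ ∣p∣≤r ∣q∣≤s)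

square-nonNeg : ∀ p → 0ℚ ≤ p * p
square-nonNeg p with ≤-total 0ℚ p
... | inj₁ 0≤p = *-nonNeg 0≤p 0≤p
... | inj₂ p≤0 = nonNegative⁻¹ (p * p) {{nonPos*nonPos⇒nonPos p {{nonPositive p≤0}} p {{nonPositive p≤0}}}}

p*p≤q*q⇒∣p∣≤q : ∀ {p q} → 0ℚ ≤ q → p * p ≤ q * q → ∣ p ∣ ≤ q
p*p≤q*q⇒∣p∣≤q {p} {q} 0≤q pp≤qq = ≮⇒≥ λ q<∣p∣ → <-irrefl refl (begin-strict
  q * q          ≤⟨ *-monoˡ-≤-nonNeg q {{nonNegative 0≤q}} (<⇒≤ q<∣p∣) ⟩
  q * ∣ p ∣      <⟨ *-monoˡ-<-pos ∣ p ∣ {{positive (≤-<-trans 0≤q q<∣p∣)}} q<∣p∣ ⟩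
  ∣ p ∣ * ∣ p ∣  ≡⟨ ∣p*q∣≡∣p∣*∣q∣ p p ⟨
  ∣ p * p ∣      ≡⟨ 0≤p⇒∣p∣≡p (square-nonNeg p) ⟩
  p * p          ≤⟨ pp≤qq ⟩
  q * q          ∎)
  where open ≤-Reasoning

-- Bisection

record SignChange (f : ℚ → ℚ) (l u : ℚ) : Set where
  field
    f-l≤0 : f l ≤ 0ℚ
    0≤f-u : 0ℚ ≤ f u
    l≤u   : l ≤ u

module Bisection (f : ℚ → ℚ) (l₀ u₀ : ℚ) where

  midpoint : ℚ → ℚ → ℚ
  midpoint l u = l + (u - l) * ½

  halve : ∀ l u → Dec (f (midpoint l u) ≤ 0ℚ) → ℚ × ℚ
  halve l u (yes _) = midpoint l u , u
  halve l u (no _)  = l , midpoint l u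

  step : ℚ × ℚ → ℚ × ℚ
  step (l , u) = halve l u (f (midpoint l u) ≤? 0ℚ)

  bracket : ℕ → ℚ × ℚ
  bracket zero = l₀ , u₀
  bracket (suc n) = step (bracket n)

  lower upper : ℕ → ℚ
  lower n = proj₁ (bracket n)
  upper n = proj₂ (bracket n)

  private
    test : ∀ n → Dec (f (midpoint (lower n) (upper n)) ≤ 0ℚ)
    test n = f (midpoint (lower n) (upper n)) ≤? 0ℚ

    midpoint-lower : ∀ l u → midpoint l u - l ≡ (u - l) * ½
    midpoint-lower = solve 2 (λ l u → l :+ (u :- l) :* con ½ :- l := (u :- l) :* con ½) refl

    midpoint-upper : ∀ l u → u - midpoint l u ≡ (u - l) * ½
    midpoint-upper = solve 2 (λ l u → u :- (l :+ (u :- l) :* con ½) := (u :- l) :* con ½) refl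

    half-nonNeg : ∀ {l u} → l ≤ u → 0ℚ ≤ (u - l) * ½
    half-nonNeg l≤u = *-nonNeg (p≤q⇒0≤q-p l≤u) (from-yes (0ℚ ≤? ½))

    halve-signChange : ∀ {l u} d → SignChange f l u → SignChange f (proj₁ (halve l u d)) (proj₂ (halve l u d))
    halve-signChange {l} {u} (yes fm≤0) record { 0≤f-u = 0≤fu ; l≤u = l≤u } = record
      { f-l≤0 = fm≤0 ; 0≤f-u = 0≤fu ; l≤u = ≤-by-difference _ (midpoint-upper l u) (half-nonNeg l≤u) }
    halve-signChange {l} {u} (no fm≰0) record { f-l≤0 = fl≤0 ; l≤u = l≤u } = record
      { f-l≤0 = fl≤0 ; 0≤f-u = <⇒≤ (≰⇒> fm≰0) ; l≤u = ≤-by-difference _ (midpoint-lower l u) (half-nonNeg l≤u) }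

    halve-nested : ∀ {l u} d → l ≤ u → l ≤ proj₁ (halve l u d) × proj₂ (halve l u d) ≤ u
    halve-nested {l} {u} (yes _) l≤u = ≤-by-difference _ (midpoint-lower l u) (half-nonNeg l≤u) , ≤-refl
    halve-nested {l} {u} (no _)  l≤u = ≤-refl , ≤-by-difference _ (midpoint-upper l u) (half-nonNeg l≤u)

    halve-width : ∀ l u d → proj₂ (halve l u d) - proj₁ (halve l u d) ≡ (u - l) * ½
    halve-width l u (yes _) = midpoint-upper l u
    halve-width l u (no _)  = midpoint-lower l u

  module Properties (initial : SignChange f l₀ u₀) where
    signChange : ∀ n → SignChange f (lower n) (upper n)
    signChange zero = initial
    signChange (suc n) = halve-signChange (test n) (signChange n)

    lower≤upper : ∀ n → lower n ≤ upper n
    lower≤upper n = SignChange.l≤u (signChange n)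

    nested : ∀ {m n} → m ℕ.≤′ n → lower m ≤ lower n × upper n ≤ upper m
    nested ℕ.≤′-refl = ≤-refl , ≤-refl
    nested {n = suc n} (ℕ.≤′-step m≤′n) =
      let lower-step , upper-step = halve-nested (test n) (lower≤upper n)
          lower-mono , upper-anti = nested m≤′n
      in ≤-trans lower-mono lower-step , ≤-trans upper-step upper-anti

    width-bound : ∀ n → toℚ (suc n) * (upper n - lower n) ≤ u₀ - l₀
    width-bound zero = ≤-reflexive (*-identityˡ _)
    width-bound (suc n) = begin
      toℚ (suc (suc n)) * w′         ≤⟨ ≤-by-difference (toℚ n * w′) shrink (*-nonNeg (toℚ-nonNeg n) 0≤w′) ⟩
      toℚ (suc n) * (w′ + w′)        ≡⟨ cong (toℚ (suc n) *_) w′+w′≡w ⟩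
      toℚ (suc n) * (upper n - lower n) ≤⟨ width-bound n ⟩
      u₀ - l₀                         ∎
      where
      open ≤-Reasoning
      w′ = upper (suc n) - lower (suc n)
      0≤w′ : 0ℚ ≤ w′
      0≤w′ = p≤q⇒0≤q-p (lower≤upper (suc n))
      halves : ∀ l u → (u - l) * ½ + (u - l) * ½ ≡ u - l
      halves = solve 2 (λ l u → (u :- l) :* con ½ :+ (u :- l) :* con ½ := u :- l) refl
      w′+w′≡w : w′ + w′ ≡ upper n - lower n
      w′+w′≡w = trans (cong (λ x → x + x) (halve-width (lower n) (upper n) (test n))) (halves (lower n) (upper n))
      identity : ∀ m w → (1ℚ + m) * (w + w) - (1ℚ + (1ℚ + m)) * w ≡ m * w
      identity = solve 2 (λ m w → (con 1ℚ :+ m) :* (w :+ w) :- (con 1ℚ :+ (con 1ℚ :+ m)) :* w := m :* w) refl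
      shrink : toℚ (suc n) * (w′ + w′) - toℚ (suc (suc n)) * w′ ≡ toℚ n * w′
      shrink rewrite toℚ-suc (suc n) | toℚ-suc n = identity (toℚ n) w′

-- The cubic and the brackets around α

p : ℚ → ℚ
p t = t * t * t - t * t - t - 1ℚ

κ : ℚ → ℚ
κ t = t * t - t - 1ℚ

pᴾ κᴾ : ∀ {n} → Polynomial n → Polynomial n
pᴾ t = t :* t :* t :- t :* t :- t :- con 1ℚ
κᴾ t = t :* t :- t :- con 1ℚ

Gᴾ : ∀ {n} → Polynomial n → Polynomial n → Polynomial n → Polynomial n
Gᴾ t y x = y :* y :+ (t :- con 1ℚ) :* x :* y :+ κᴾ t :* x :* x

p-slope : ℚ → ℚ → ℚ
p-slope s t = s * s + s * t + t * t - s - t - 1ℚ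

p-difference : ∀ s t → p t - p s ≡ (t - s) * p-slope s t
p-difference = solve 2 (λ s t → pᴾ t :- pᴾ s := (t :- s) :* (s :* s :+ s :* t :+ t :* t :- s :- t :- con 1ℚ)) refl

G : ℚ → ℚ → ℚ → ℚ
G t y x = y * y + (t - 1ℚ) * x * y + κ t * x * x

δ : ℚ → ℚ
δ t = toℚ 4 * κ t - (t - 1ℚ) * (t - 1ℚ)

G-complete-square : ∀ t y x → toℚ 4 * G t y x ≡ (toℚ 2 * y + (t - 1ℚ) * x) * (toℚ 2 * y + (t - 1ℚ) * x) + δ t * (x * x)
G-complete-square = solve 3 (λ t y x →
  con (toℚ 4) :* Gᴾ t y x
    := (con (toℚ 2) :* y :+ (t :- con 1ℚ) :* x) :* (con (toℚ 2) :* y :+ (t :- con 1ℚ) :* x)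
       :+ (con (toℚ 4) :* κᴾ t :- (t :- con 1ℚ) :* (t :- con 1ℚ)) :* (x :* x)) refl

¾ : ℚ
¾ = ℤ.+ 3 / 4

-- (3/4)² = 9/16 exceeds κ α = 1/α ≈ 0.544, and (μ 3)² ≈ 0.590 exceeds 3 Q 3 t ≈ 0.48 near α.
μ : ℕ → ℚ
μ zero = ℤ.+ 91 / 50
μ (suc i) = ¾ * μ i

-- Convergents of α with l₀ < α < u₀.  The terms ε i t with i < 34 are evaluated exactly at them,
-- which needs them within about 10⁻¹² of α.  They are opaque: letting the type checker unfold them
-- while checking the definitions below is prohibitively slow.
opaque
  l₀ u₀ : ℚ
  l₀ = ℤ.+ 4133442 / 2247307
  u₀ = ℤ.+ 883483 / 480340

opaque
  unfolding l₀ u₀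
  α-signChange : SignChange p l₀ u₀
  α-signChange = record
    { f-l≤0 = from-yes (p l₀ ≤? 0ℚ) ; 0≤f-u = from-yes (0ℚ ≤? p u₀) ; l≤u = from-yes (l₀ ≤? u₀) }

open Bisection p l₀ u₀ using (lower; upper)
open Bisection.Properties p l₀ u₀ α-signChange using (signChange; lower≤upper; nested; width-bound)

record InBracket (n : ℕ) (t : ℚ) : Set where
  constructor inBracket
  field
    lower≤t : lower n ≤ t
    t≤upper : t ≤ upper n

InRegion : ℚ → Set
InRegion = InBracket 0

bracket⊆bracket : ∀ {m n t} → m ℕ.≤ n → InBracket n t → InBracket m t
bracket⊆bracket m≤n (inBracket lower≤t t≤upper) =
  let lower-mono , upper-anti = nested (ℕ.≤⇒≤′ m≤n)
  in inBracket (≤-trans lower-mono lower≤t) (≤-trans t≤upper upper-anti)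

bracket⊆region : ∀ {n t} → InBracket n t → InRegion t
bracket⊆region = bracket⊆bracket ℕ.z≤n

opaque
  unfolding l₀ u₀

  region-nonNeg : ∀ {t} → InRegion t → 0ℚ ≤ t
  region-nonNeg (inBracket l₀≤t _) = ≤-trans (from-yes (0ℚ ≤? l₀)) l₀≤t

  region-product : ∀ {s t} → InRegion s → InRegion t → l₀ * l₀ ≤ s * t × s * t ≤ u₀ * u₀
  region-product s∈@(inBracket l₀≤s s≤u₀) t∈@(inBracket l₀≤t t≤u₀) =
      *-mono-≤-nonNeg (from-yes (0ℚ ≤? l₀)) l₀≤s (from-yes (0ℚ ≤? l₀)) l₀≤t
    , *-mono-≤-nonNeg (region-nonNeg s∈) s≤u₀ (region-nonNeg t∈) t≤u₀

  κ-bounds : ∀ {t} → InRegion t → ℤ.+ 27 / 50 ≤ κ t × κ t ≤ ℤ.+ 9 / 16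
  κ-bounds t∈@(inBracket l₀≤t t≤u₀) = let l₀²≤t² , t²≤u₀² = region-product t∈ t∈ in
      ≤-trans (from-yes (ℤ.+ 27 / 50 ≤? l₀ * l₀ - u₀ - 1ℚ)) (sub-mono-≤ (sub-mono-≤ l₀²≤t² t≤u₀) (≤-refl {1ℚ}))
    , ≤-trans (sub-mono-≤ (sub-mono-≤ t²≤u₀² l₀≤t) (≤-refl {1ℚ})) (from-yes (u₀ * u₀ - l₀ - 1ℚ ≤? ℤ.+ 9 / 16))

  p-slope-bounds : ∀ {s t} → InRegion s → InRegion t → 0ℚ ≤ p-slope s t × p-slope s t ≤ toℚ 6
  p-slope-bounds s∈@(inBracket l₀≤s s≤u₀) t∈@(inBracket l₀≤t t≤u₀) =
    let ss₁ , ss₂ = region-product s∈ s∈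
        st₁ , st₂ = region-product s∈ t∈
        tt₁ , tt₂ = region-product t∈ t∈
    in
      ≤-trans (from-yes (0ℚ ≤? l₀ * l₀ + l₀ * l₀ + l₀ * l₀ - u₀ - u₀ - 1ℚ))
        (sub-mono-≤ (sub-mono-≤ (sub-mono-≤ (+-mono-≤ (+-mono-≤ ss₁ st₁) tt₁) s≤u₀) t≤u₀) (≤-refl {1ℚ}))
    , ≤-trans (sub-mono-≤ (sub-mono-≤ (sub-mono-≤ (+-mono-≤ (+-mono-≤ ss₂ st₂) tt₂) l₀≤s) l₀≤t) (≤-refl {1ℚ}))
        (from-yes (u₀ * u₀ + u₀ * u₀ + u₀ * u₀ - l₀ - l₀ - 1ℚ ≤? toℚ 6))

  6*[u₀-l₀]≤1 : toℚ 6 * (u₀ - l₀) ≤ 1ℚ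
  6*[u₀-l₀]≤1 = from-yes (toℚ 6 * (u₀ - l₀) ≤? 1ℚ)

  ∣t∣≤2 : ∀ {t} → InRegion t → ∣ t ∣ ≤ toℚ 2
  ∣t∣≤2 t∈@(inBracket _ t≤u₀) = -q≤p≤q⇒∣p∣≤q
    (≤-trans (from-yes (- toℚ 2 ≤? 0ℚ)) (region-nonNeg t∈)) (≤-trans t≤u₀ (from-yes (u₀ ≤? toℚ 2)))

  ∣t-1∣≤1 : ∀ {t} → InRegion t → ∣ t - 1ℚ ∣ ≤ 1ℚ
  ∣t-1∣≤1 (inBracket l₀≤t t≤u₀) = -q≤p≤q⇒∣p∣≤q
    (≤-trans (from-yes (- 1ℚ ≤? l₀ - 1ℚ)) (sub-mono-≤ l₀≤t (≤-refl {1ℚ})))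
    (≤-trans (sub-mono-≤ t≤u₀ (≤-refl {1ℚ})) (from-yes (u₀ - 1ℚ ≤? 1ℚ)))

  δ-bound : ∀ {t} → InRegion t → toℚ 4 ≤ toℚ 3 * δ t
  δ-bound t∈@(inBracket l₀≤t t≤u₀) =
    let t-1≤u₀-1 = sub-mono-≤ t≤u₀ (≤-refl {1ℚ})
        0≤t-1 = ≤-trans (from-yes (0ℚ ≤? l₀ - 1ℚ)) (sub-mono-≤ l₀≤t (≤-refl {1ℚ}))
    in ≤-trans (from-yes (toℚ 4 ≤? toℚ 3 * (toℚ 4 * (ℤ.+ 27 / 50) - (u₀ - 1ℚ) * (u₀ - 1ℚ))))
         (*-monoˡ-≤-nonNeg (toℚ 3)
           (sub-mono-≤ (*-monoˡ-≤-nonNeg (toℚ 4) (proj₁ (κ-bounds t∈))) (*-mono-≤-nonNeg 0≤t-1 t-1≤u₀-1 0≤t-1 t-1≤u₀-1)))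

  slack₃-bound : ∀ {t} → InRegion t →
             1ℚ ≤ toℚ 10 * (μ 3 * μ 3 - toℚ 3 * ((toℚ 2 - t) * (toℚ 2 - t) * (t * t + t + 1ℚ)))
  slack₃-bound t∈@(inBracket l₀≤t t≤u₀) =
    let 0≤2-t = ≤-trans (from-yes (0ℚ ≤? toℚ 2 - u₀)) (sub-mono-≤ (≤-refl {toℚ 2}) t≤u₀)
        2-t≤2-l₀ = sub-mono-≤ (≤-refl {toℚ 2}) l₀≤t
        0≤t = region-nonNeg t∈
        0≤t²+t+1 = +-nonNeg (+-nonNeg (*-nonNeg 0≤t 0≤t) 0≤t) (from-yes (0ℚ ≤? 1ℚ))
        t²+t+1≤ = +-mono-≤ (+-mono-≤ (proj₂ (region-product t∈ t∈)) t≤u₀) (≤-refl {1ℚ})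
    in ≤-trans (from-yes (1ℚ ≤? toℚ 10 * (μ 3 * μ 3 - toℚ 3 * ((toℚ 2 - l₀) * (toℚ 2 - l₀) * (u₀ * u₀ + u₀ + 1ℚ)))))
         (*-monoˡ-≤-nonNeg (toℚ 10) (+-monoʳ-≤ (μ 3 * μ 3) (neg-antimono-≤ (*-monoˡ-≤-nonNeg (toℚ 3)
           (*-mono-≤-nonNeg (*-nonNeg 0≤2-t 0≤2-t) (*-mono-≤-nonNeg 0≤2-t 2-t≤2-l₀ 0≤2-t 2-t≤2-l₀) 0≤t²+t+1 t²+t+1≤)))))

p-mono-≤ : ∀ {s t} → InRegion s → InRegion t → s ≤ t → p s ≤ p t
p-mono-≤ {s} {t} s∈ t∈ s≤t = ≤-by-difference _ (p-difference s t)
  (*-nonNeg (p≤q⇒0≤q-p s≤t) (proj₁ (p-slope-bounds s∈ t∈)))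

p-lipschitz : ∀ {s t} → InRegion s → InRegion t → s ≤ t → p t - p s ≤ toℚ 6 * (t - s)
p-lipschitz {s} {t} s∈ t∈ s≤t = begin
  p t - p s              ≡⟨ p-difference s t ⟩
  (t - s) * p-slope s t  ≤⟨ *-monoˡ-≤-nonNeg (t - s) {{nonNegative (p≤q⇒0≤q-p s≤t)}} (proj₂ (p-slope-bounds s∈ t∈)) ⟩
  (t - s) * (toℚ 6)  ≡⟨ *-comm (t - s) _ ⟩
  toℚ 6 * (t - s)    ∎
  where open ≤-Reasoning

∣p∣≤width : ∀ {n t} → InBracket n t → ∣ p t ∣ ≤ toℚ 6 * (upper n - lower n)
∣p∣≤width {n} {t} t∈@(inBracket l≤t t≤u) = -q≤p≤q⇒∣p∣≤q
  (begin
    - (toℚ 6 * (u - l))  ≤⟨ neg-antimono-≤ (p-lipschitz l∈ u∈ (lower≤upper n)) ⟩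
    - (p u - p l)            ≡⟨ identity (p u) (p l) ⟩
    p l - p u                ≤⟨ +-monoʳ-≤ (p l) (neg-antimono-≤ (SignChange.0≤f-u (signChange n))) ⟩
    p l - 0ℚ                 ≡⟨ +-identityʳ (p l) ⟩
    p l                      ≤⟨ p-mono-≤ l∈ (bracket⊆region t∈) l≤t ⟩
    p t                      ∎)
  (begin
    p t                      ≤⟨ p-mono-≤ (bracket⊆region t∈) u∈ t≤u ⟩
    p u                      ≡⟨ +-identityʳ (p u) ⟨
    p u - 0ℚ                 ≤⟨ +-monoʳ-≤ (p u) (neg-antimono-≤ (SignChange.f-l≤0 (signChange n))) ⟩
    p u - p l                ≤⟨ p-lipschitz l∈ u∈ (lower≤upper n) ⟩
    toℚ 6 * (u - l)      ∎)
  where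
  open ≤-Reasoning
  l = lower n
  u = upper n
  l∈ : InRegion l
  l∈ = bracket⊆region {n} (inBracket ≤-refl (lower≤upper n))
  u∈ : InRegion u
  u∈ = bracket⊆region {n} (inBracket (lower≤upper n) ≤-refl)
  identity : ∀ x y → - (x - y) ≡ y - x
  identity = solve 2 (λ x y → :- (x :- y) := y :- x) refl

Near : (ℚ → Set) → Set
Near P = ∃[ n ] (∀ {t} → InBracket n t → P t)

near-region : ∀ {P} → (∀ {t} → InRegion t → P t) → Near P
near-region P-region = 0 , P-region

near-zip : ∀ {P Q R} → (∀ {t} → InRegion t → P t → Q t → R t) → Near P → Near Q → Near R
near-zip combine (m , P-near) (n , Q-near) = m ℕ.+ n , λ t∈ →
  combine (bracket⊆region t∈) (P-near (bracket⊆bracket (ℕ.m≤m+n m n) t∈)) (Q-near (bracket⊆bracket (ℕ.m≤n+m n m) t∈))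

near-map : ∀ {P Q} → (∀ {t} → InRegion t → P t → Q t) → Near P → Near Q
near-map f (n , P-near) = n , λ t∈ → f (bracket⊆region t∈) (P-near t∈)

near-small-p : ∀ m → Near (λ t → toℚ m * ∣ p t ∣ ≤ 1ℚ)
near-small-p m = m , λ {t} t∈ → begin
  toℚ m * ∣ p t ∣                                  ≤⟨ *-monoʳ-≤-nonNeg ∣ p t ∣ {{∣-∣-nonNeg (p t)}} m≤1+m ⟩
  toℚ (suc m) * ∣ p t ∣                            ≤⟨ *-monoˡ-≤-nonNeg (toℚ (suc m)) {{nonNegative (toℚ-nonNeg (suc m))}}
                                                        (∣p∣≤width t∈) ⟩
  toℚ (suc m) * (toℚ 6 * (upper m - lower m))  ≡⟨ x∙yz≈y∙xz (toℚ (suc m)) (toℚ 6) (upper m - lower m) ⟩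
  toℚ 6 * (toℚ (suc m) * (upper m - lower m))  ≤⟨ *-monoˡ-≤-nonNeg (toℚ 6) (width-bound m) ⟩
  toℚ 6 * (u₀ - l₀)                            ≤⟨ 6*[u₀-l₀]≤1 ⟩
  1ℚ                                               ∎
  where
  open ≤-Reasoning
  m≤1+m : toℚ m ≤ toℚ (suc m)
  m≤1+m = ≤-by-difference 1ℚ (trans (cong (_- toℚ m) (toℚ-suc m)) (identity (toℚ m))) (from-yes (0ℚ ≤? 1ℚ))
    where
    identity : ∀ x → 1ℚ + x - x ≡ 1ℚ
    identity = solve 1 (λ x → con 1ℚ :+ x :- x := con 1ℚ) refl

∣p∣≤1 : ∀ {t} → InRegion t → ∣ p t ∣ ≤ 1ℚ
∣p∣≤1 t∈ = ≤-trans (∣p∣≤width {0} t∈) 6*[u₀-l₀]≤1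

1≤K*x⇒0≤x : ∀ {K x} → 0ℚ ≤ K → 1ℚ ≤ K * x → 0ℚ ≤ x
1≤K*x⇒0≤x {K} {x} 0≤K 1≤Kx = ≮⇒≥ λ x<0 → <-irrefl refl (begin-strict
  0ℚ      <⟨ from-yes (0ℚ <? 1ℚ) ⟩
  1ℚ      ≤⟨ 1≤Kx ⟩
  K * x   ≤⟨ *-monoˡ-≤-nonNeg K {{nonNegative 0≤K}} (<⇒≤ x<0) ⟩
  K * 0ℚ  ≡⟨ *-zeroʳ K ⟩
  0ℚ      ∎)
  where open ≤-Reasoning

x²≤3G : ∀ {t} y x → InRegion t → x * x ≤ toℚ 3 * G t y x
x²≤3G {t} y x t∈ = *-cancelˡ-≤-pos (toℚ 4) (begin
  toℚ 4 * (x * x)                   ≤⟨ *-monoʳ-≤-nonNeg (x * x) {{nonNegative 0≤x²}} (δ-bound t∈) ⟩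
  toℚ 3 * δ t * (x * x)            ≤⟨ ≤-by-difference _ (identity m (δ t) (x * x))
                                          (*-nonNeg (from-yes (0ℚ ≤? toℚ 3)) (square-nonNeg m)) ⟩
  toℚ 3 * (m * m + δ t * (x * x))  ≡⟨ cong (toℚ 3 *_) (G-complete-square t y x) ⟨
  toℚ 3 * (toℚ 4 * G t y x)    ≡⟨ x∙yz≈y∙xz (toℚ 3) (toℚ 4) (G t y x) ⟩
  toℚ 4 * (toℚ 3 * G t y x)    ∎)
  where
  open ≤-Reasoning
  m = toℚ 2 * y + (t - 1ℚ) * x
  0≤x² = square-nonNeg x
  identity : ∀ m d z → toℚ 3 * (m * m + d * z) - toℚ 3 * d * z ≡ toℚ 3 * (m * m)
  identity = solve 3 (λ m d z → con (toℚ 3) :* (m :* m :+ d :* z) :- con (toℚ 3) :* d :* z := con (toℚ 3) :* (m :* m)) refl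

-- The sign of the homogenised cubic

G-zero : ∀ t y → G t y 0ℚ ≡ y * y
G-zero = solve 2 (λ t y → Gᴾ t y (con 0ℚ) := y :* y) refl

y≢0⇒0<y*y : ∀ {y} → y ≢ 0ℚ → 0ℚ < y * y
y≢0⇒0<y*y {y} y≢0 with <-cmp y 0ℚ
... | tri< y<0 _ _ = positive⁻¹ (y * y) {{neg*neg⇒pos y {{negative y<0}} y {{negative y<0}}}}
... | tri≈ _ y≡0 _ = contradiction y≡0 y≢0
... | tri> _ _ 0<y = *-pos 0<y 0<y

G-pos : ∀ {t y x} → InRegion t → 0ℚ ≤ x → y ≢ t * x → 0ℚ < G t y x
G-pos {t} {y} {x} t∈ 0≤x y≢tx with <-cmp 0ℚ x
... | tri< 0<x _ _ = *-cancelˡ-<-nonNeg (toℚ 3) (begin-strict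
      toℚ 3 * 0ℚ       ≡⟨ *-zeroʳ (toℚ 3) ⟩
      0ℚ                    <⟨ *-pos 0<x 0<x ⟩
      x * x                 ≤⟨ x²≤3G y x t∈ ⟩
      toℚ 3 * G t y x  ∎)
  where open ≤-Reasoning
... | tri≈ _ refl _ = subst (0ℚ <_) (sym (G-zero t y)) (y≢0⇒0<y*y (λ y≡0 → y≢tx (trans y≡0 (sym (*-zeroʳ t)))))
... | tri> _ _ x<0 = contradiction (<-≤-trans x<0 0≤x) (<-irrefl refl)

cubicH-factor : ∀ t y x → cubicH y x ≡ x * x * x * p t + (y - t * x) * G t y x
cubicH-factor = solve 3 (λ t y x →
  y :* y :* y :- y :* y :* x :- y :* x :* x :- x :* x :* x := x :* x :* x :* pᴾ t :+ (y :- t :* x) :* Gᴾ t y x) refl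

cube-nonNeg : ∀ {x} → 0ℚ ≤ x → 0ℚ ≤ x * x * x
cube-nonNeg 0≤x = *-nonNeg (*-nonNeg 0≤x 0≤x) 0≤x

cubicH<0 : ∀ {l y x} → InRegion l → p l ≤ 0ℚ → 0ℚ ≤ x → y < l * x → cubicH y x < 0ℚ
cubicH<0 {l} {y} {x} l∈ pl≤0 0≤x y<lx = begin-strict
  cubicH y x                               ≡⟨ cubicH-factor l y x ⟩
  x * x * x * p l + (y - l * x) * G l y x  <⟨ +-mono-≤-< x³pl≤0 [y-lx]G<0 ⟩
  0ℚ                                       ∎
  where
  open ≤-Reasoning
  x³pl≤0 : x * x * x * p l ≤ 0ℚ
  x³pl≤0 = begin
    x * x * x * p l  ≤⟨ *-monoˡ-≤-nonNeg (x * x * x) {{nonNegative (cube-nonNeg 0≤x)}} pl≤0 ⟩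
    x * x * x * 0ℚ   ≡⟨ *-zeroʳ (x * x * x) ⟩
    0ℚ               ∎
  [y-lx]G<0 : (y - l * x) * G l y x < 0ℚ
  [y-lx]G<0 = begin-strict
    (y - l * x) * G l y x  <⟨ *-monoˡ-<-pos (G l y x) {{positive (G-pos l∈ 0≤x (<⇒≢ y<lx))}} (+-monoˡ-< (- (l * x)) y<lx) ⟩
    (l * x - l * x) * G l y x  ≡⟨ cong (_* G l y x) (+-inverseʳ (l * x)) ⟩
    0ℚ * G l y x           ≡⟨ *-zeroˡ (G l y x) ⟩
    0ℚ                     ∎

0<cubicH : ∀ {u y x} → InRegion u → 0ℚ ≤ p u → 0ℚ ≤ x → u * x < y → 0ℚ < cubicH y x
0<cubicH {u} {y} {x} u∈ 0≤pu 0≤x ux<y = begin-strict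
  0ℚ                                       <⟨ +-mono-≤-< (*-nonNeg (cube-nonNeg 0≤x) 0≤pu) 0<[y-ux]G ⟩
  x * x * x * p u + (y - u * x) * G u y x  ≡⟨ cubicH-factor u y x ⟨
  cubicH y x                               ∎
  where
  open ≤-Reasoning
  0<[y-ux]G : 0ℚ < (y - u * x) * G u y x
  0<[y-ux]G = *-pos (p<q⇒0<q-p ux<y) (G-pos u∈ 0≤x (≢-sym (<⇒≢ ux<y)))

-- The errors ε i

ε : ℕ → ℚ → ℚ
ε i t = toℚ (T (suc i)) - t * toℚ (T i)

ε-antitone : ∀ i {s t} → s ≤ t → ε i t ≤ ε i s
ε-antitone i {s} {t} s≤t =
  ≤-by-difference _ (identity (toℚ (T (suc i))) (toℚ (T i)) s t) (*-nonNeg (p≤q⇒0≤q-p s≤t) (toℚ-nonNeg (T i)))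
  where
  identity : ∀ a b s t → (a - s * b) - (a - t * b) ≡ (t - s) * b
  identity = solve 4 (λ a b s t → (a :- s :* b) :- (a :- t :* b) := (t :- s) :* b) refl

toℚ-T-recurrence : ∀ i → toℚ (T (suc (suc (suc i)))) ≡ toℚ (T (suc (suc i))) + toℚ (T (suc i)) + toℚ (T i)
toℚ-T-recurrence i =
  trans (toℚ-+ (T (suc (suc i)) ℕ.+ T (suc i)) (T i)) (cong (_+ toℚ (T i)) (toℚ-+ (T (suc (suc i))) (T (suc i))))

ε-recurrence : ∀ i t → ε (suc (suc i)) t ≡ (1ℚ - t) * ε (suc i) t - κ t * ε i t - p t * toℚ (T i)
ε-recurrence i t = trans (cong (_- t * toℚ (T (suc (suc i)))) (toℚ-T-recurrence i))
                         (identity (toℚ (T i)) (toℚ (T (suc i))) (toℚ (T (suc (suc i)))) t)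
  where
  identity : ∀ x y z t → z + y + x - t * z ≡ (1ℚ - t) * (z - t * y) - κ t * (y - t * x) - p t * x
  identity = solve 4 (λ x y z t →
    z :+ y :+ x :- t :* z := (con 1ℚ :- t) :* (z :- t :* y) :- κᴾ t :* (y :- t :* x) :- pᴾ t :* x) refl

Q : ℕ → ℚ → ℚ
Q i t = G t (ε (suc i) t) (ε i t)

S : ℕ → ℚ → ℚ
S i t = toℚ 2 * ε (suc (suc i)) t + (t - 1ℚ) * ε (suc i) t + p t * toℚ (T i)

G-step : ∀ t e₀ e₁ w → G t ((1ℚ - t) * e₁ - κ t * e₀ - w) e₁
                     ≡ κ t * G t e₁ e₀ - w * (toℚ 2 * ((1ℚ - t) * e₁ - κ t * e₀ - w) + (t - 1ℚ) * e₁ + w)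
G-step = solve 4 (λ t e₀ e₁ w →
  Gᴾ t ((con 1ℚ :- t) :* e₁ :- κᴾ t :* e₀ :- w) e₁
    := κᴾ t :* Gᴾ t e₁ e₀
       :- w :* (con (toℚ 2) :* ((con 1ℚ :- t) :* e₁ :- κᴾ t :* e₀ :- w) :+ (t :- con 1ℚ) :* e₁ :+ w)) refl

Q-recurrence : ∀ i t → Q (suc i) t ≡ κ t * Q i t - p t * toℚ (T i) * S i t
Q-recurrence i t = begin
  G t (ε (suc (suc i)) t) e₁                        ≡⟨ cong (λ y → G t y e₁) (ε-recurrence i t) ⟩
  G t ((1ℚ - t) * e₁ - κ t * e₀ - w) e₁             ≡⟨ G-step t e₀ e₁ w ⟩
  κ t * Q i t - w * (toℚ 2 * ((1ℚ - t) * e₁ - κ t * e₀ - w) + (t - 1ℚ) * e₁ + w)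
    ≡⟨ cong (λ y → κ t * Q i t - w * (toℚ 2 * y + (t - 1ℚ) * e₁ + w)) (ε-recurrence i t) ⟨
  κ t * Q i t - w * S i t                           ∎
  where
  open ≡-Reasoning
  e₀ = ε i t
  e₁ = ε (suc i) t
  w = p t * toℚ (T i)

E : ℕ → ℕ
E j = T (suc j) ℕ.+ 2 ℕ.* T j

∣ε∣≤E : ∀ j {t} → InRegion t → ∣ ε j t ∣ ≤ toℚ (E j)
∣ε∣≤E j {t} t∈ =
  subst (∣ ε j t ∣ ≤_) (sym (trans (toℚ-+ (T (suc j)) (2 ℕ.* T j)) (cong (toℚ (T (suc j)) +_) (toℚ-* 2 (T j)))))
  (∣p-q∣≤r+s (≤-reflexive (∣toℚ∣ (T (suc j)))) (∣p*q∣≤r*s (∣t∣≤2 t∈) (≤-reflexive (∣toℚ∣ (T j)))))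

B : ℕ → ℕ
B i = T i ℕ.* (2 ℕ.* E (suc (suc i)) ℕ.+ E (suc i) ℕ.+ T i)

∣pTS∣≤∣p∣B : ∀ i {t} → InRegion t → ∣ p t * toℚ (T i) * S i t ∣ ≤ (∣ p t ∣) * toℚ (B i)
∣pTS∣≤∣p∣B i {t} t∈ = begin
  ∣ p t * toℚ (T i) * S i t ∣              ≡⟨ trans (∣p*q∣≡∣p∣*∣q∣ (p t * toℚ (T i)) (S i t))
                                                   (cong (_* (∣ S i t ∣)) (∣p*q∣≡∣p∣*∣q∣ (p t) (toℚ (T i)))) ⟩
  (∣ p t ∣) * (∣ toℚ (T i) ∣) * (∣ S i t ∣)  ≡⟨ cong (λ x → (∣ p t ∣) * x * (∣ S i t ∣)) (∣toℚ∣ (T i)) ⟩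
  (∣ p t ∣) * toℚ (T i) * (∣ S i t ∣)        ≡⟨ *-assoc (∣ p t ∣) (toℚ (T i)) (∣ S i t ∣) ⟩
  (∣ p t ∣) * (toℚ (T i) * ∣ S i t ∣)        ≤⟨ *-monoˡ-≤-nonNeg (∣ p t ∣) {{∣-∣-nonNeg (p t)}}
                                               (*-monoˡ-≤-nonNeg (toℚ (T i)) {{nonNegative (toℚ-nonNeg (T i))}} ∣S∣≤) ⟩
  (∣ p t ∣) * (toℚ (T i) * (toℚ 2 * toℚ (E (suc (suc i))) + toℚ (E (suc i)) + toℚ (T i)))
                                           ≡⟨ cong ((∣ p t ∣) *_) toℚ-B ⟨
  (∣ p t ∣) * toℚ (B i)                      ∎
  where
  open ≤-Reasoning
  ∣S∣≤ : ∣ S i t ∣ ≤ toℚ 2 * toℚ (E (suc (suc i))) + toℚ (E (suc i)) + toℚ (T i)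
  ∣S∣≤ = subst (∣ S i t ∣ ≤_) (cong₂ (λ x y → toℚ 2 * toℚ (E (suc (suc i))) + x + y) (*-identityˡ _) (*-identityˡ _))
    (∣p+q∣≤r+s (∣p+q∣≤r+s (∣p*q∣≤r*s {toℚ 2} ≤-refl (∣ε∣≤E (suc (suc i)) t∈)) (∣p*q∣≤r*s (∣t-1∣≤1 t∈) (∣ε∣≤E (suc i) t∈)))
            (∣p*q∣≤r*s (∣p∣≤1 t∈) (≤-reflexive (∣toℚ∣ (T i)))))
  toℚ-B : toℚ (B i) ≡ toℚ (T i) * (toℚ 2 * toℚ (E (suc (suc i))) + toℚ (E (suc i)) + toℚ (T i))
  toℚ-B = trans (toℚ-* (T i) _) (cong (toℚ (T i) *_)
    (trans (toℚ-+ (2 ℕ.* E (suc (suc i)) ℕ.+ E (suc i)) (T i)) (cong (_+ toℚ (T i))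
      (trans (toℚ-+ (2 ℕ.* E (suc (suc i))) (E (suc i))) (cong (_+ toℚ (E (suc i))) (toℚ-* 2 (E (suc (suc i)))))))))

margin-step : ∀ {K c k q Q w} → 0ℚ ≤ K → k ≤ c → 1ℚ ≤ toℚ 2 * k → 0ℚ ≤ q → 1ℚ ≤ K * (q - Q) →
              toℚ 4 * K * ∣ w ∣ ≤ 1ℚ → 1ℚ ≤ toℚ 4 * K * (c * q - k * Q + w)
margin-step {K} {c} {k} {q} {Q} {w} 0≤K k≤c 1≤2k 0≤q 1≤K[q-Q] 4K∣w∣≤1 =
  ≤-by-difference _ (identity K c k q Q w)
    (+-nonNeg (+-nonNeg (+-nonNeg
      (*-nonNeg (*-nonNeg 0≤4K (p≤q⇒0≤q-p k≤c)) 0≤q)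
      (*-nonNeg (*-nonNeg (+-nonNeg 0≤K 0≤K) (p≤q⇒0≤q-p 1≤2k)) (1≤K*x⇒0≤x 0≤K 1≤K[q-Q])))
      (+-nonNeg (p≤q⇒0≤q-p 1≤K[q-Q]) (p≤q⇒0≤q-p 1≤K[q-Q])))
      (p≤q⇒0≤q-p (≤-trans (neg-antimono-≤ 4K∣w∣≤1) -4K∣w∣≤4Kw)))
  where
  0≤4K : 0ℚ ≤ toℚ 4 * K
  0≤4K = *-nonNeg (from-yes (0ℚ ≤? toℚ 4)) 0≤K
  -4K∣w∣≤4Kw : - (toℚ 4 * K * ∣ w ∣) ≤ toℚ 4 * K * w
  -4K∣w∣≤4Kw = ≤-trans (≤-reflexive (neg-distribʳ-* (toℚ 4 * K) ∣ w ∣))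
                       (*-monoˡ-≤-nonNeg (toℚ 4 * K) {{nonNegative 0≤4K}} (-∣p∣≤p w))
  identity : ∀ K c k q Q w → toℚ 4 * K * (c * q - k * Q + w) - 1ℚ
           ≡ toℚ 4 * K * (c - k) * q + (K + K) * (toℚ 2 * k - 1ℚ) * (q - Q)
             + ((K * (q - Q) - 1ℚ) + (K * (q - Q) - 1ℚ)) + (toℚ 4 * K * w - - 1ℚ)
  identity = solve 6 (λ K c k q Q w →
    con (toℚ 4) :* K :* (c :* q :- k :* Q :+ w) :- con 1ℚ
      := con (toℚ 4) :* K :* (c :- k) :* q :+ (K :+ K) :* (con (toℚ 2) :* k :- con 1ℚ) :* (q :- Q)
         :+ ((K :* (q :- Q) :- con 1ℚ) :+ (K :* (q :- Q) :- con 1ℚ)) :+ (con (toℚ 4) :* K :* w :- :- con 1ℚ)) refl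

μ-nonNeg : ∀ i → 0ℚ ≤ μ i
μ-nonNeg zero = from-yes (0ℚ ≤? μ 0)
μ-nonNeg (suc i) = *-nonNeg (from-yes (0ℚ ≤? ¾)) (μ-nonNeg i)

slack : ℕ → ℚ → ℚ
slack i t = μ i * μ i - toℚ 3 * Q i t

Q₃-closed-form : ∀ t → Q 3 t ≡ (toℚ 2 - t) * (toℚ 2 - t) * (t * t + t + 1ℚ)
Q₃-closed-form = solve 1 (λ t →
  Gᴾ t (con (toℚ (T 5)) :- t :* con (toℚ (T 4))) (con (toℚ (T 4)) :- t :* con (toℚ (T 3)))
    := (con (toℚ 2) :- t) :* (con (toℚ 2) :- t) :* (t :* t :+ t :+ con 1ℚ)) refl

slack-step : ∀ i K {t} → InRegion t → 1ℚ ≤ toℚ K * slack i t → toℚ (12 ℕ.* B i ℕ.* K) * ∣ p t ∣ ≤ 1ℚ →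
             1ℚ ≤ toℚ (4 ℕ.* K) * slack (suc i) t
slack-step i K {t} t∈ margin small = subst (1ℚ ≤_) (sym rearrange)
  (margin-step (toℚ-nonNeg K) (proj₂ (κ-bounds t∈)) 1≤2κ (square-nonNeg (μ i)) margin 4K∣3v∣≤1)
  where
  open ≤-Reasoning
  v = p t * toℚ (T i) * S i t
  1≤2κ : 1ℚ ≤ toℚ 2 * κ t
  1≤2κ = ≤-trans (from-yes (1ℚ ≤? toℚ 2 * (ℤ.+ 27 / 50))) (*-monoˡ-≤-nonNeg (toℚ 2) (proj₁ (κ-bounds t∈)))
  rearrange : toℚ (4 ℕ.* K) * slack (suc i) t
            ≡ toℚ 4 * toℚ K * (¾ * ¾ * (μ i * μ i) - κ t * (toℚ 3 * Q i t) + toℚ 3 * v)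
  rearrange = begin-equality
    toℚ (4 ℕ.* K) * slack (suc i) t
      ≡⟨ cong₂ _*_ (toℚ-* 4 K) (cong (λ q → μ (suc i) * μ (suc i) - toℚ 3 * q) (Q-recurrence i t)) ⟩
    toℚ 4 * toℚ K * (¾ * μ i * (¾ * μ i) - toℚ 3 * (κ t * Q i t - v))
      ≡⟨ identity (toℚ K) ¾ (μ i) (κ t) (Q i t) v ⟩
    toℚ 4 * toℚ K * (¾ * ¾ * (μ i * μ i) - κ t * (toℚ 3 * Q i t) + toℚ 3 * v) ∎
    where
    identity : ∀ K a m k Q v → toℚ 4 * K * (a * m * (a * m) - toℚ 3 * (k * Q - v))
                             ≡ toℚ 4 * K * (a * a * (m * m) - k * (toℚ 3 * Q) + toℚ 3 * v)
    identity = solve 6 (λ K a m k Q v →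
      con (toℚ 4) :* K :* (a :* m :* (a :* m) :- con (toℚ 3) :* (k :* Q :- v))
        := con (toℚ 4) :* K :* (a :* a :* (m :* m) :- k :* (con (toℚ 3) :* Q) :+ con (toℚ 3) :* v)) refl
  4K∣3v∣≤1 : toℚ 4 * toℚ K * ∣ toℚ 3 * v ∣ ≤ 1ℚ
  4K∣3v∣≤1 = begin
    toℚ 4 * toℚ K * ∣ toℚ 3 * v ∣         ≡⟨ cong (toℚ 4 * toℚ K *_) (∣p*q∣≡∣p∣*∣q∣ (toℚ 3) v) ⟩
    toℚ 4 * toℚ K * (toℚ 3 * ∣ v ∣)       ≤⟨ *-monoˡ-≤-nonNeg (toℚ 4 * toℚ K) {{nonNegative (*-nonNeg (from-yes (0ℚ ≤? toℚ 4)) (toℚ-nonNeg K))}}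
                                                      (*-monoˡ-≤-nonNeg (toℚ 3) (∣pTS∣≤∣p∣B i t∈)) ⟩
    toℚ 4 * toℚ K * (toℚ 3 * ((∣ p t ∣) * toℚ (B i)))  ≡⟨ identity (toℚ K) (∣ p t ∣) (toℚ (B i)) ⟩
    toℚ 12 * toℚ (B i) * toℚ K * ∣ p t ∣       ≡⟨ cong (_* ∣ p t ∣) (trans (toℚ-* (12 ℕ.* B i) K) (cong (_* toℚ K) (toℚ-* 12 (B i)))) ⟨
    toℚ (12 ℕ.* B i ℕ.* K) * ∣ p t ∣                ≤⟨ small ⟩
    1ℚ                                             ∎
    where
    identity : ∀ K a b → toℚ 4 * K * (toℚ 3 * (a * b)) ≡ toℚ 12 * b * K * a
    identity = solve 3 (λ K a b → con (toℚ 4) :* K :* (con (toℚ 3) :* (a :* b)) := con (toℚ 12) :* b :* K :* a) refl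

near-slack-margin : ∀ j → ∃[ K ] Near (λ t → 1ℚ ≤ toℚ K * slack (suc (suc (suc j))) t)
near-slack-margin zero = 10 , near-region λ {t} t∈ →
  subst (λ q → 1ℚ ≤ toℚ 10 * (μ 3 * μ 3 - toℚ 3 * q)) (sym (Q₃-closed-form t)) (slack₃-bound t∈)
near-slack-margin (suc j) =
  let K , near = near-slack-margin j
  in 4 ℕ.* K , near-zip (λ t∈ → slack-step (suc (suc (suc j))) K t∈) near (near-small-p (12 ℕ.* B (suc (suc (suc j))) ℕ.* K))

near-∣ε∣≤μ : ∀ {i} → 3 ℕ.≤ i → Near (λ t → ∣ ε i t ∣ ≤ μ i)
near-∣ε∣≤μ {suc (suc (suc j))} (ℕ.s≤s (ℕ.s≤s (ℕ.s≤s _))) =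
  let K , near = near-slack-margin j
  in near-map (λ {t} t∈ margin → p*p≤q*q⇒∣p∣≤q (μ-nonNeg i)
       (≤-trans (x²≤3G (ε (suc i) t) (ε i t) t∈) (≤-by-difference _ refl (1≤K*x⇒0≤x (toℚ-nonNeg K) margin)))) near
  where i = suc (suc (suc j))

∑ : List ℕ → (ℕ → ℚ) → ℚ
∑ [] f = 0ℚ
∑ (i ∷ is) f = f i + ∑ is f

∑-mono-≤ : ∀ {f g} is → All (λ i → f i ≤ g i) is → ∑ is f ≤ ∑ is g
∑-mono-≤ [] [] = ≤-refl
∑-mono-≤ (i ∷ is) (fi≤gi ∷ f≤g) = +-mono-≤ fi≤gi (∑-mono-≤ is f≤g)

∑-cong : ∀ {f g} is → All (λ i → f i ≡ g i) is → ∑ is f ≡ ∑ is g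
∑-cong [] [] = refl
∑-cong (i ∷ is) (fi≡gi ∷ f≡g) = cong₂ _+_ fi≡gi (∑-cong is f≡g)

∑-neg : ∀ f is → ∑ is (λ i → - f i) ≡ - ∑ is f
∑-neg f [] = refl
∑-neg f (i ∷ is) = trans (cong (- f i +_) (∑-neg f is)) (sym (neg-distrib-+ (f i) (∑ is f)))

∑range : ℕ → ℕ → (ℕ → ℚ) → ℚ
∑range a zero f = 0ℚ
∑range a (suc m) f = f a + ∑range (suc a) m f

∑range-nonNeg : ∀ {f} → (∀ k → 0ℚ ≤ f k) → ∀ a m → 0ℚ ≤ ∑range a m f
∑range-nonNeg f≥0 a zero = ≤-refl
∑range-nonNeg f≥0 a (suc m) = +-nonNeg (f≥0 a) (∑range-nonNeg f≥0 (suc a) m)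

∑range-cong : ∀ {f g} a m → (∀ {k} → a ℕ.≤ k → k ℕ.< a ℕ.+ m → f k ≡ g k) → ∑range a m f ≡ ∑range a m g
∑range-cong a zero f≡g = refl
∑range-cong a (suc m) f≡g = cong₂ _+_
  (f≡g ℕ.≤-refl (subst (a ℕ.<_) (sym (ℕ.+-suc a m)) (ℕ.s≤s (ℕ.m≤m+n a m))))
  (∑range-cong (suc a) m λ {k} a<k k<1+a+m → f≡g (ℕ.<⇒≤ a<k) (subst (k ℕ.<_) (sym (ℕ.+-suc a m)) k<1+a+m))

∑range-+ : ∀ f a m n → ∑range a (m ℕ.+ n) f ≡ ∑range a m f + ∑range (a ℕ.+ m) n f
∑range-+ f a zero n = trans (cong (λ b → ∑range b n f) (sym (ℕ.+-identityʳ a))) (sym (+-identityˡ _))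
∑range-+ f a (suc m) n = begin
  f a + ∑range (suc a) (m ℕ.+ n) f                          ≡⟨ cong (f a +_) (∑range-+ f (suc a) m n) ⟩
  f a + (∑range (suc a) m f + ∑range (suc a ℕ.+ m) n f)     ≡⟨ +-assoc (f a) _ _ ⟨
  f a + ∑range (suc a) m f + ∑range (suc a ℕ.+ m) n f       ≡⟨ cong (λ b → f a + ∑range (suc a) m f + ∑range b n f) (sym (ℕ.+-suc a m)) ⟩
  f a + ∑range (suc a) m f + ∑range (a ℕ.+ suc m) n f       ∎
  where open ≡-Reasoning

_without_ : (ℕ → ℚ) → ℕ → ℕ → ℚ
(f without j) k with k ℕ.≟ j
... | yes _ = 0ℚ
... | no _  = f k

without-≢ : ∀ f {j k} → k ≢ j → (f without j) k ≡ f k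
without-≢ f {j} {k} k≢j with k ℕ.≟ j
... | yes k≡j = contradiction k≡j k≢j
... | no _    = refl

without-nonNeg : ∀ {f} j → (∀ k → 0ℚ ≤ f k) → ∀ k → 0ℚ ≤ (f without j) k
without-nonNeg j f≥0 k with k ℕ.≟ j
... | yes _ = ≤-refl
... | no _  = f≥0 k

∑range-without : ∀ f a m {j} → a ℕ.≤ j → j ℕ.< a ℕ.+ m → ∑range a m f ≡ f j + ∑range a m (f without j)
∑range-without f a zero a≤j j<a+0 = contradiction (subst (_ ℕ.<_) (ℕ.+-identityʳ a) j<a+0) (ℕ.≤⇒≯ a≤j)
∑range-without f a (suc m) {j} a≤j j<a+1+m with a ℕ.≟ j
... | yes refl = begin
  f a + ∑range (suc a) m f                                ≡⟨ cong (f a +_) (∑range-cong (suc a) m λ a<k _ → without-≢ f (ℕ.>⇒≢ a<k)) ⟨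
  f a + ∑range (suc a) m (f without a)                    ≡⟨ cong (f a +_) (+-identityˡ _) ⟨
  f a + (0ℚ + ∑range (suc a) m (f without a))             ∎
  where open ≡-Reasoning
... | no a≢j = begin
  f a + ∑range (suc a) m f                                ≡⟨ cong (f a +_) (∑range-without f (suc a) m (ℕ.≤∧≢⇒< a≤j a≢j) j<1+a+m) ⟩
  f a + (f j + ∑range (suc a) m (f without j))            ≡⟨ swap (f a) (f j) _ ⟩
  f j + (f a + ∑range (suc a) m (f without j))            ∎
  where
  open ≡-Reasoning
  j<1+a+m = subst (j ℕ.<_) (ℕ.+-suc a m) j<a+1+m
  swap : ∀ x y z → x + (y + z) ≡ y + (x + z)
  swap = solve 3 (λ x y z → x :+ (y :+ z) := y :+ (x :+ z)) refl

∑≤∑range : ∀ {f} → (∀ k → 0ℚ ≤ f k) → ∀ a m is → Unique is →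
           All (λ i → a ℕ.≤ i × i ℕ.< a ℕ.+ m) is → ∑ is f ≤ ∑range a m f
∑≤∑range f≥0 a m [] [] [] = ∑range-nonNeg f≥0 a m
∑≤∑range {f} f≥0 a m (j ∷ is) (j∉is ∷ unique) ((a≤j , j<a+m) ∷ in-range) = begin
  f j + ∑ is f                  ≡⟨ cong (f j +_) (∑-cong is (All.map (λ j≢i → without-≢ f (≢-sym j≢i)) j∉is)) ⟨
  f j + ∑ is (f without j)      ≤⟨ +-monoʳ-≤ (f j) (∑≤∑range (without-nonNeg j f≥0) a m is unique in-range) ⟩
  f j + ∑range a m (f without j) ≡⟨ ∑range-without f a m a≤j j<a+m ⟨
  ∑range a m f                  ∎
  where open ≤-Reasoning

∑range-μ : ∀ a m → ∑range a m μ ≤ toℚ 4 * μ a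
∑range-μ a zero = *-nonNeg (from-yes (0ℚ ≤? toℚ 4)) (μ-nonNeg a)
∑range-μ a (suc m) = begin
  μ a + ∑range (suc a) m μ      ≤⟨ +-monoʳ-≤ (μ a) (∑range-μ (suc a) m) ⟩
  μ a + toℚ 4 * (¾ * μ a)   ≡⟨ identity (μ a) ¾ ⟩
  (1ℚ + toℚ 4 * ¾) * μ a    ∎
  where
  open ≤-Reasoning
  identity : ∀ m c → m + toℚ 4 * (c * m) ≡ (1ℚ + toℚ 4 * c) * m
  identity = solve 2 (λ m c → m :+ con (toℚ 4) :* (c :* m) := (con 1ℚ :+ con (toℚ 4) :* c) :* m) refl

withTail : (ℕ → ℚ) → ℕ → ℚ
withTail c i with i ℕ.<? 34
... | yes _ = c i
... | no _  = μ i

withTail-nonNeg : ∀ {c} → (∀ i → 0ℚ ≤ c i) → ∀ i → 0ℚ ≤ withTail c i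
withTail-nonNeg c≥0 i with i ℕ.<? 34
... | yes _ = c≥0 i
... | no _  = μ-nonNeg i

≤sum : ∀ is → All (ℕ._≤ sum is) is
≤sum [] = []
≤sum (i ∷ is) = ℕ.m≤m+n i (sum is) ∷ All.map (λ i≤ → ℕ.≤-trans i≤ (ℕ.m≤n+m (sum is) i)) (≤sum is)

∑-withTail-≤ : ∀ c → (∀ i → 0ℚ ≤ c i) → ∀ is → Unique is → All (3 ℕ.≤_) is →
               ∑ is (withTail c) ≤ ∑range 3 31 c + toℚ 4 * μ 34
∑-withTail-≤ c c≥0 is unique 3≤is = begin
  ∑ is (withTail c)                                            ≤⟨ ∑≤∑range (withTail-nonNeg c≥0) 3 (31 ℕ.+ sum is) is unique in-range ⟩
  ∑range 3 (31 ℕ.+ sum is) (withTail c)                        ≡⟨ ∑range-+ (withTail c) 3 31 (sum is) ⟩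
  ∑range 3 31 (withTail c) + ∑range 34 (sum is) (withTail c)   ≡⟨ cong₂ _+_ (∑range-cong 3 31 below) (∑range-cong 34 (sum is) above) ⟩
  ∑range 3 31 c + ∑range 34 (sum is) μ                         ≤⟨ +-monoʳ-≤ (∑range 3 31 c) (∑range-μ 34 (sum is)) ⟩
  ∑range 3 31 c + toℚ 4 * μ 34                             ∎
  where
  open ≤-Reasoning
  in-range : All (λ i → 3 ℕ.≤ i × i ℕ.< 3 ℕ.+ (31 ℕ.+ sum is)) is
  in-range = All.zipWith (λ (3≤i , i≤s) → 3≤i , ℕ.s≤s (ℕ.≤-trans i≤s (ℕ.m≤n+m (sum is) 33))) (3≤is , ≤sum is)
  below : ∀ {k} → 3 ℕ.≤ k → k ℕ.< 34 → withTail c k ≡ c k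
  below {k} _ k<34 with k ℕ.<? 34
  ... | yes _   = refl
  ... | no k≮34 = contradiction k<34 k≮34
  above : ∀ {k} → 34 ℕ.≤ k → k ℕ.< 34 ℕ.+ sum is → withTail c k ≡ μ k
  above {k} 34≤k _ with k ℕ.<? 34
  ... | yes k<34 = contradiction k<34 (ℕ.≤⇒≯ 34≤k)
  ... | no _     = refl

-- T itself takes exponential time to evaluate; the numerical checks below go through T-fast.
T-triple : ℕ → ℕ × ℕ × ℕ
T-triple zero = 0 , 0 , 1
T-triple (suc n) with T-triple n
... | x , y , z = y , z , z ℕ.+ y ℕ.+ x

T-fast : ℕ → ℕ
T-fast n = proj₁ (T-triple n)

T≡T-fast : ∀ n → T n ≡ T-fast n
T≡T-fast n = cong proj₁ (sym (T-triple-correct n))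
  where
  T-triple-correct : ∀ n → T-triple n ≡ (T n , T (suc n) , T (suc (suc n)))
  T-triple-correct zero = refl
  T-triple-correct (suc n) rewrite T-triple-correct n = refl

εᶠ : ℕ → ℚ → ℚ
εᶠ i t = toℚ (T-fast (suc i)) - t * toℚ (T-fast i)

ε≡εᶠ : ∀ i t → ε i t ≡ εᶠ i t
ε≡εᶠ i t = cong₂ (λ y x → toℚ y - t * toℚ x) (T≡T-fast (suc i)) (T≡T-fast i)

upperBound lowerBound : ℕ → ℚ
upperBound i = 0ℚ ⊔ εᶠ i l₀
lowerBound i = 0ℚ ⊔ - εᶠ i u₀

opaque
  unfolding l₀ u₀

  upperBound-sum : ∑range 3 31 upperBound + toℚ 4 * μ 34 < c085
  upperBound-sum = from-yes (∑range 3 31 upperBound + toℚ 4 * μ 34 <? c085)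

  lowerBound-sum : ∑range 3 31 lowerBound + toℚ 4 * μ 34 < c085
  lowerBound-sum = from-yes (∑range 3 31 lowerBound + toℚ 4 * μ 34 <? c085)

near-ε≤upperBound : ∀ {i} → 3 ℕ.≤ i → Near (λ t → ε i t ≤ withTail upperBound i)
near-ε≤upperBound {i} 3≤i with i ℕ.<? 34
... | yes _ = near-region λ {t} (inBracket l₀≤t _) →
                ≤-trans (ε-antitone i l₀≤t) (≤-trans (≤-reflexive (ε≡εᶠ i l₀)) (p≤q⊔p 0ℚ (εᶠ i l₀)))
... | no _  = near-map (λ _ → ∣p∣≤q⇒p≤q) (near-∣ε∣≤μ 3≤i)

near--ε≤lowerBound : ∀ {i} → 3 ℕ.≤ i → Near (λ t → - ε i t ≤ withTail lowerBound i)
near--ε≤lowerBound {i} 3≤i with i ℕ.<? 34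
... | yes _ = near-region λ {t} (inBracket _ t≤u₀) →
                ≤-trans (neg-antimono-≤ (ε-antitone i t≤u₀)) (≤-trans (≤-reflexive (cong -_ (ε≡εᶠ i u₀))) (p≤q⊔p 0ℚ (- εᶠ i u₀)))
... | no _  = near-map (λ _ ∣ε∣≤μ → -q≤p⇒-p≤q (∣p∣≤q⇒-q≤p ∣ε∣≤μ)) (near-∣ε∣≤μ 3≤i)

near-all : ∀ {P : ℕ → ℚ → Set} {is} → All (λ i → Near (P i)) is → Near (λ t → All (λ i → P i t) is)
near-all [] = near-region (λ _ → [])
near-all (near ∷ nears) = near-zip (λ _ → _∷_) near (near-all nears)

near-∑ : ∀ (g : ℕ → ℚ → ℚ) c → (∀ i → 0ℚ ≤ c i) → (∀ {i} → 3 ℕ.≤ i → Near (λ t → g i t ≤ withTail c i)) →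
         ∀ is → Unique is → All (3 ℕ.≤_) is → Near (λ t → ∑ is (λ i → g i t) ≤ ∑range 3 31 c + toℚ 4 * μ 34)
near-∑ g c c≥0 near-g is unique 3≤is =
  near-map (λ _ g≤c → ≤-trans (∑-mono-≤ is g≤c) (∑-withTail-≤ c c≥0 is unique 3≤is)) (near-all (All.map near-g 3≤is))

outOf-sub≡∑ε : ∀ is t → toℚ (outOf is) - t * toℚ (sum (map T is)) ≡ ∑ is (λ i → ε i t)
outOf-sub≡∑ε [] t = identity t
  where
  identity : ∀ t → 0ℚ - t * 0ℚ ≡ 0ℚ
  identity = solve 1 (λ t → con 0ℚ :- t :* con 0ℚ := con 0ℚ) refl
outOf-sub≡∑ε (i ∷ is) t = begin
  toℚ (T (suc i) ℕ.+ outOf is) - t * toℚ (T i ℕ.+ sum (map T is))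
    ≡⟨ cong₂ (λ a b → a - t * b) (toℚ-+ (T (suc i)) (outOf is)) (toℚ-+ (T i) (sum (map T is))) ⟩
  toℚ (T (suc i)) + toℚ (outOf is) - t * (toℚ (T i) + toℚ (sum (map T is)))
    ≡⟨ identity (toℚ (T (suc i))) (toℚ (outOf is)) (toℚ (T i)) (toℚ (sum (map T is))) t ⟩
  ε i t + (toℚ (outOf is) - t * toℚ (sum (map T is)))
    ≡⟨ cong (ε i t +_) (outOf-sub≡∑ε is t) ⟩
  ε i t + ∑ is (λ i → ε i t) ∎
  where
  open ≡-Reasoning
  identity : ∀ a A b B t → a + A - t * (b + B) ≡ a - t * b + (A - t * B)
  identity = solve 5 (λ a A b B t → a :+ A :- t :* (b :+ B) := a :- t :* b :+ (A :- t :* B)) refl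

near-upper-estimate : ∀ {is n} → IsCanonicalRep is n → Near (λ t → toℚ (outOf is) - t * toℚ n < c085)
near-upper-estimate {is} (unique , 3≤is , _ , refl) =
  near-map (λ {t} _ ∑ε≤ → subst (_< c085) (sym (outOf-sub≡∑ε is t)) (≤-<-trans ∑ε≤ upperBound-sum))
    (near-∑ ε upperBound (λ i → p≤p⊔q 0ℚ (εᶠ i l₀)) near-ε≤upperBound is unique 3≤is)

near-lower-estimate : ∀ {is n} → IsCanonicalRep is n → Near (λ t → - c085 < toℚ (outOf is) - t * toℚ n)
near-lower-estimate {is} (unique , 3≤is , _ , refl) =
  near-map (λ {t} _ ∑-ε≤ → -p<q⇒-q<p (subst (_< c085) (trans (∑-neg (λ i → ε i t) is) (cong -_ (sym (outOf-sub≡∑ε is t))))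
                                                  (≤-<-trans ∑-ε≤ lowerBound-sum)))
    (near-∑ (λ i t → - ε i t) lowerBound (λ i → p≤p⊔q 0ℚ (- εᶠ i u₀)) near--ε≤lowerBound is unique 3≤is)

<α·-from-bracket : ∀ {y} n N → y < lower N * toℚ n → y <α· n
<α·-from-bracket n N =
  cubicH<0 (bracket⊆region {N} (inBracket ≤-refl (lower≤upper N))) (SignChange.f-l≤0 (signChange N)) (toℚ-nonNeg n)

α·<-from-bracket : ∀ {y} n N → upper N * toℚ n < y → α· n < y
α·<-from-bracket n N =
  0<cubicH (bracket⊆region {N} (inBracket (lower≤upper N) ≤-refl)) (SignChange.0≤f-u (signChange N)) (toℚ-nonNeg n)

outOf-c085<α·n : ∀ {is n} → IsCanonicalRep is n → (toℚ (outOf is) - c085) <α· n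
outOf-c085<α·n {is} {n} rep =
  let N , near = near-upper-estimate rep
  in <α·-from-bracket {toℚ (outOf is) - c085} n N (<-by-difference _ (identity (toℚ (outOf is)) (lower N * toℚ n) c085)
                                                   (p<q⇒0<q-p (near (inBracket ≤-refl (lower≤upper N)))))
  where
  identity : ∀ x y c → y - (x - c) ≡ c - (x - y)
  identity = solve 3 (λ x y c → y :- (x :- c) := c :- (x :- y)) refl

α·n<outOf+c085 : ∀ {is n} → IsCanonicalRep is n → α· n < (toℚ (outOf is) + c085)
α·n<outOf+c085 {is} {n} rep =
  let N , near = near-lower-estimate rep
  in α·<-from-bracket {toℚ (outOf is) + c085} n N (<-by-difference _ (identity (toℚ (outOf is)) (upper N * toℚ n) c085)
                                                   (p<q⇒0<q-p (near (inBracket (lower≤upper N) ≤-refl))))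
  where
  identity : ∀ x y c → x + c - y ≡ x - y - - c
  identity = solve 3 (λ x y c → x :+ c :- y := x :- y :- :- c) refl

mainTheorem1 : (n : ℕ) →
    ∃ (λ (is : List ℕ) → IsCanonicalRep is n)
    × (∀ (is : List ℕ) → IsCanonicalRep is n →
         ((toℚ (outOf is) - c085) <α· n) × (α· n < (toℚ (outOf is) + c085)))
mainTheorem1 n = canonicalRep-exists n , λ _ rep → outOf-c085<α·n rep , α·n<outOf+c085 rep
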